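{- Let $m\ge 2$ and $1\le p\le m-1$. Then ${\cal F}^{TG}_{m,p}(x)={\cal F}^{TG}_{m,m-p}(x)$, where ${\cal F}^{TG}_{m,p}(x)=\sum_{n\ge1}f^{TG}_{m,p}(n)x^n$ and $f^{TG}_{m,p}(n)$ is the number of 2-factors of $TG^{(p)}_m(n)$; equivalently, $f^{TG}_{m,p}(n)=f^{TG}_{m,m-p}(n)$ for all $n\ge 1$.
   Context: Torus grid $TG^{(p)}_m(n)$ ($m\ge 2$, $n\ge1$, $0\le p\le m-1$): row indices are taken mod $m$ in $\{1,\dots,m\}$. It is the multigraph (loops and parallel edges allowed; for $m,n\ge 3$ the usual simple graph) on vertex set $\{1,\dots,m\}\times\{1,\dots,n\}$ in which every edge-end carries a direction: for every $j$ and $1\le i\le m$, a vertical edge joining $(i,j)$ (end "down") to $(i+1,j)$ (end "up"); for every $i$ and $1\le j\le n-1$, a horizontal edge joining $(i,j)$ (end "right") to $(i,j+1)$ (end "left"); and for each $1\le i\le m$, an edge joining $(i+p,n)$ (end "right") to $(i,1)$ (end "left"). (It arises from $C_m\times P_{n+1}$ by identifying the vertex in row $i$ of the first column with the vertex in row $i+p$ of the last column.) A 2-factor is a set of edges such that every vertex carries exactly two edge-ends of chosen edges (a loop contributes two). -}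

module Defs where

open import Data.Nat using (ℕ; zero; suc; _+_; _≟_)
open import Data.Nat.DivMod using (_mod_)
open import Data.Fin using (Fin; zero; suc; toℕ)
import Data.Fin as F
open import Data.Fin.Properties using (all?)
open import Data.Product using (_×_; _,_)
open import Data.Product.Properties using (≡-dec)
open import Data.Maybe using (Maybe; just; nothing)
import Data.Maybe as M
open import Data.List using (List; []; _∷_; length; filter; concatMap; _++_; map)
open import Data.List using () renaming (allFin to allFinL)
open import Data.Vec using (Vec; []; _∷_)
open import Data.Bool using (Bool; true; false)
open import Relation.Binary.PropositionalEquality using (_≡_)
open import Relation.Nullary using (Dec; yes; no)

-- Conventions: rows 1..m are represented by Fin m (row r ↦ r-1), columns
-- 1..n by Fin n. Row indices are taken modulo m.

Vertex : ℕ → ℕ → Set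
Vertex m n = Fin m × Fin n

data Dir : Set where
  up down left right : Dir

Edge : ℕ → ℕ → Set
Edge m n = (Vertex m n × Dir) × (Vertex m n × Dir)

shift : ∀ {m} → ℕ → Fin m → Fin m
shift {suc m} k i = (toℕ i + k) mod (suc m)

nextCol : ∀ {n} → Fin n → Maybe (Fin n)
nextCol {suc zero} zero = nothing
nextCol {suc (suc n)} zero = just (suc zero)
nextCol {suc (suc n)} (suc j) = M.map suc (nextCol j)

firstCol : ∀ {n} → Fin n → Fin n
firstCol {suc n} _ = zero

tgEdges : (m p n : ℕ) → List (Edge m n)
tgEdges m p n = vertical ++ horizontal ++ wrap
  where
  rows = allFinL m
  cols = allFinL n
  vertical : List (Edge m n)
  vertical = concatMap (λ i → map (λ j → ((i , j) , down) , ((shift 1 i , j) , up)) cols) rows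
  horizontal : List (Edge m n)
  horizontal = concatMap (λ i → concatMap (λ j → hor i j (nextCol j)) cols) rows
    where
    hor : Fin m → Fin n → Maybe (Fin n) → List (Edge m n)
    hor i j (just j') = (((i , j) , right) , ((i , j') , left)) ∷ []
    hor i j nothing = []
  -- (i+p,n) [right] -- (i,1) [left]
  wrap : List (Edge m n)
  wrap = concatMap (λ i → concatMap (λ j → wr i j (nextCol j)) cols) rows
    where
    wr : Fin m → Fin n → Maybe (Fin n) → List (Edge m n)
    wr i j nothing = (((shift p i , j) , right) , ((i , firstCol j) , left)) ∷ []
    wr i j (just _) = []

_≟V_ : ∀ {m n} → (u v : Vertex m n) → Dec (u ≡ v)
_≟V_ = ≡-dec F._≟_ F._≟_

[_≟_]₀₁ : ∀ {m n} → Vertex m n → Vertex m n → ℕ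
[ u ≟ v ]₀₁ with u ≟V v
... | yes _ = 1
... | no _ = 0

-- number of edge-ends at v of the edge e (a loop contributes 2)
endsAt : ∀ {m n} → Vertex m n → Edge m n → ℕ
endsAt v ((a , _) , (b , _)) = [ a ≟ v ]₀₁ + [ b ≟ v ]₀₁

-- a set of edges = a Bool selection vector over the edge list;
-- deg counts edge-ends at v of chosen edges
deg : ∀ {m n} (es : List (Edge m n)) → Vec Bool (length es) → Vertex m n → ℕ
deg [] [] v = 0
deg (e ∷ es) (true ∷ s) v = endsAt v e + deg es s v
deg (e ∷ es) (false ∷ s) v = deg es s v

IsTwoFactor : ∀ {m n} (es : List (Edge m n)) → Vec Bool (length es) → Set
IsTwoFactor {m} {n} es s = (i : Fin m) (j : Fin n) → deg es s (i , j) ≡ 2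

isTwoFactor? : ∀ {m n} (es : List (Edge m n)) (s : Vec Bool (length es)) → Dec (IsTwoFactor es s)
isTwoFactor? es s = all? (λ i → all? (λ j → deg es s (i , j) ≟ 2))

allSelections : (k : ℕ) → List (Vec Bool k)
allSelections zero = [] ∷ []
allSelections (suc k) = map (true ∷_) (allSelections k) ++ map (false ∷_) (allSelections k)

fTG : (m p n : ℕ) → ℕ
fTG m p n = length (filter (isTwoFactor? (tgEdges m p n)) (allSelections (length (tgEdges m p n))))

-- Reflecting the rows, (i , j) ↦ (m−1−i , j), is an isomorphism from TG^{(p)}_m(n) onto
-- TG^{(m−p)}_m(n): vertical edges go to vertical edges, horizontal edges to horizontal edges,
-- and the wrap-around edge (i+p , n)–(i , 1) goes to (−1−i−p , n)–(−1−i , 1), which is the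
-- wrap-around edge of row −1−i for the shift −p ≡ m−p.  Concretely, the reflection maps the
-- edge list of the first graph onto a permutation of the edge list of the second, and the
-- number of 2-factors, computed by deciding for each edge in turn whether to take it, is
-- invariant under both relabelling the vertices and permuting the edges.
module Submission where

open import Defs
open import Data.Nat using (ℕ; zero; suc; _+_; _*_; _∸_; _≤_; _≟_; NonZero)
open import Data.Nat.Properties
  using ( +-identityʳ; +-assoc; +-comm; +-mono-≤; +-monoʳ-≤; +-cancelˡ-≤; ≤-trans; ≤-reflexive
        ; m≤m+n; m≤n⇒m≤1+n; n≮n; n<1+n; m+n∸m≡n; m+[n∸m]≡n; +-commutativeSemigroup)
open import Algebra.Properties.CommutativeSemigroup +-commutativeSemigroup using (interchange; xy∙z≈xz∙y)
open import Data.Nat.DivMod using (_%_; _/_; m≡m%n+[m/n]*n; %-distribˡ-+; m%n%n≡m%n; [m+n]%n≡m%n; m<n⇒m%n≡m)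
open import Data.Nat.Tactic.RingSolver using (solve-∀)
open import Data.Fin using (Fin; toℕ; opposite)
open import Data.Fin.Properties
  using (all?; toℕ-injective; toℕ-fromℕ<; toℕ≤pred[n]; opposite-prop; opposite-involutive)
open import Data.Maybe using (Maybe; just; nothing)
open import Data.Product using (_,_; proj₁; proj₂)
open import Data.List using (List; []; _∷_; length; filter; map; _++_; concatMap; allFin)
open import Data.List.Properties
  using (length-++; filter-++; map-++; map-∘; map-cong; map-concatMap; concatMap-cong; concatMap-map)
open import Data.List.Relation.Binary.Permutation.Propositional as ↭ using (_↭_; module PermutationReasoning)
open import Data.List.Relation.Binary.Permutation.Propositional.Properties using (++⁺)
open import Data.List.Relation.Binary.BagAndSetEquality using (>>=-cong; ↭⇒∼bag; ∼bag⇒↭)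
open import Data.List.Membership.Propositional using (_∈_)
open import Data.List.Membership.Propositional.Properties using (∈-map⁺; ∈-allFin)
open import Data.List.Membership.Propositional.Properties.WithK using (unique∧set⇒bag)
open import Data.List.Relation.Unary.Unique.Propositional.Properties using (allFin⁺; map⁺)
open import Data.Vec using (Vec; []; _∷_)
open import Data.Bool using (Bool; true; false; if_then_else_)
open import Data.Empty using (⊥-elim)
open import Function using (_∘_; id)
open import Function.Bundles using (mk⇔)
open import Function.Related.Propositional using (K-refl)
open import Level using (Level)
open import Relation.Binary.PropositionalEquality
  using (_≡_; _≗_; refl; sym; trans; cong; cong₂; subst; module ≡-Reasoning)
open import Relation.Nullary using (Dec; does; yes; no; contradiction)
open import Relation.Nullary.Decidable using (does-⇔)
open import Relation.Unary using (Pred; Decidable; _≐_)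

m≤n+n∧m%[1+n]≡n⇒m≡n : ∀ {m n} → m ≤ n + n → m % suc n ≡ n → m ≡ n
m≤n+n∧m%[1+n]≡n⇒m≡n {m} {n} m≤n+n m%[1+n]≡n =
  from-quotient (m / suc n) (trans (m≡m%n+[m/n]*n m (suc n)) (cong (_+ (m / suc n) * suc n) m%[1+n]≡n))
  where
  from-quotient : ∀ q → m ≡ n + q * suc n → m ≡ n
  from-quotient zero    m≡n+0 = trans m≡n+0 (+-identityʳ n)
  from-quotient (suc q) m≡n+[1+q][1+n] = ⊥-elim (n≮n n (+-cancelˡ-≤ n (suc n) n
    (≤-trans (+-monoʳ-≤ n (m≤m+n (suc n) (q * suc n)))
             (≤-trans (≤-reflexive (sym m≡n+[1+q][1+n])) m≤n+n))))

[m+n%d]%d≡[m+n]%d : ∀ m n d .{{_ : NonZero d}} → (m + n % d) % d ≡ (m + n) % d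
[m+n%d]%d≡[m+n]%d m n d = begin
  (m + n % d) % d           ≡⟨ %-distribˡ-+ m (n % d) d ⟩
  (m % d + n % d % d) % d   ≡⟨ cong (λ k → (m % d + k) % d) (m%n%n≡m%n n d) ⟩
  (m % d + n % d) % d       ≡⟨ %-distribˡ-+ m n d ⟨
  (m + n) % d               ∎
  where open ≡-Reasoning

module _ {K : ℕ} where

  toℕ-shift : ∀ q (i : Fin (suc K)) → toℕ (shift q i) ≡ (toℕ i + q) % suc K
  toℕ-shift q i = toℕ-fromℕ< _

  [a+shift]%≡[a+i+q]% : ∀ a q (i : Fin (suc K)) → (a + toℕ (shift q i)) % suc K ≡ (a + toℕ i + q) % suc K
  [a+shift]%≡[a+i+q]% a q i = begin
    (a + toℕ (shift q i)) % suc K        ≡⟨ cong (λ k → (a + k) % suc K) (toℕ-shift q i) ⟩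
    (a + (toℕ i + q) % suc K) % suc K    ≡⟨ [m+n%d]%d≡[m+n]%d a (toℕ i + q) (suc K) ⟩
    (a + (toℕ i + q)) % suc K            ≡⟨ cong (_% suc K) (+-assoc a (toℕ i) q) ⟨
    (a + toℕ i + q) % suc K              ∎
    where open ≡-Reasoning

  toℕ-+-opposite : ∀ (i : Fin (suc K)) → toℕ i + toℕ (opposite i) ≡ K
  toℕ-+-opposite i = trans (cong (toℕ i +_) (opposite-prop i)) (m+[n∸m]≡n (toℕ≤pred[n] i))

  opposite-unique : ∀ (i j : Fin (suc K)) → (toℕ i + toℕ j) % suc K ≡ K → j ≡ opposite i
  opposite-unique i j [i+j]%≡K = toℕ-injective (begin
    toℕ j                    ≡⟨ m+n∸m≡n (toℕ i) (toℕ j) ⟨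
    toℕ i + toℕ j ∸ toℕ i    ≡⟨ cong (_∸ toℕ i) (m≤n+n∧m%[1+n]≡n⇒m≡n i+j≤K+K [i+j]%≡K) ⟩
    K ∸ toℕ i                ≡⟨ opposite-prop i ⟨
    toℕ (opposite i)         ∎)
    where
    open ≡-Reasoning
    i+j≤K+K : toℕ i + toℕ j ≤ K + K
    i+j≤K+K = +-mono-≤ (toℕ≤pred[n] i) (toℕ≤pred[n] j)

  shift₁-opposite-shift₁ : ∀ (i : Fin (suc K)) → shift 1 (opposite (shift 1 i)) ≡ opposite i
  shift₁-opposite-shift₁ i = opposite-unique i (shift 1 o) (begin
    (toℕ i + toℕ (shift 1 o)) % suc K    ≡⟨ [a+shift]%≡[a+i+q]% (toℕ i) 1 o ⟩
    (toℕ i + toℕ o + 1) % suc K          ≡⟨ cong (λ k → (k + 1) % suc K) (+-comm (toℕ i) (toℕ o)) ⟩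
    (toℕ o + toℕ i + 1) % suc K          ≡⟨ [a+shift]%≡[a+i+q]% (toℕ o) 1 i ⟨
    (toℕ o + toℕ (shift 1 i)) % suc K    ≡⟨ cong (_% suc K) (trans (+-comm (toℕ o) _) (toℕ-+-opposite (shift 1 i))) ⟩
    K % suc K                            ≡⟨ m<n⇒m%n≡m (n<1+n K) ⟩
    K                                    ∎)
    where
    open ≡-Reasoning
    o : Fin (suc K)
    o = opposite (shift 1 i)

  shift-∸-opposite : ∀ p (i : Fin (suc K)) → p ≤ suc K → shift (suc K ∸ p) (opposite i) ≡ opposite (shift p i)
  shift-∸-opposite p i p≤1+K = opposite-unique (shift p i) (shift (suc K ∸ p) o) (begin
    (toℕ (shift p i) + toℕ (shift (suc K ∸ p) o)) % suc K
      ≡⟨ [a+shift]%≡[a+i+q]% (toℕ (shift p i)) (suc K ∸ p) o ⟩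
    (toℕ (shift p i) + toℕ o + (suc K ∸ p)) % suc K
      ≡⟨ cong (_% suc K) (rotate (toℕ (shift p i)) (toℕ o) (suc K ∸ p)) ⟩
    (toℕ o + (suc K ∸ p) + toℕ (shift p i)) % suc K
      ≡⟨ [a+shift]%≡[a+i+q]% (toℕ o + (suc K ∸ p)) p i ⟩
    (toℕ o + (suc K ∸ p) + toℕ i + p) % suc K
      ≡⟨ cong (_% suc K) (regroup (toℕ o) (suc K ∸ p) (toℕ i) p) ⟩
    ((toℕ i + toℕ o) + (p + (suc K ∸ p))) % suc K
      ≡⟨ cong₂ (λ a b → (a + b) % suc K) (toℕ-+-opposite i) (m+[n∸m]≡n p≤1+K) ⟩
    (K + suc K) % suc K
      ≡⟨ [m+n]%n≡m%n K (suc K) ⟩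
    K % suc K
      ≡⟨ m<n⇒m%n≡m (n<1+n K) ⟩
    K ∎)
    where
    open ≡-Reasoning
    o : Fin (suc K)
    o = opposite i
    rotate : ∀ a b c → a + b + c ≡ b + c + a
    rotate = solve-∀
    regroup : ∀ a b c d → a + b + c + d ≡ (c + a) + (d + b)
    regroup = solve-∀

module _ {A B : Set} where

  concatMap-↭ : (f : A → List B) {xs ys : List A} → xs ↭ ys → concatMap f xs ↭ concatMap f ys
  concatMap-↭ f xs↭ys = ∼bag⇒↭ (>>=-cong (↭⇒∼bag xs↭ys) (λ _ → K-refl))

  length-filter-map : {p q : Level} {P : Pred B p} {Q : Pred A q} (P? : Decidable P) (Q? : Decidable Q) (f : A → B) →
                      (P ∘ f) ≐ Q → ∀ xs → length (filter P? (map f xs)) ≡ length (filter Q? xs)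
  length-filter-map P? Q? f P∘f≐Q []       = refl
  length-filter-map P? Q? f P∘f≐Q (x ∷ xs) with P? (f x) | Q? x
  ... | yes _  | yes _  = cong suc (length-filter-map P? Q? f P∘f≐Q xs)
  ... | no _   | no _   = length-filter-map P? Q? f P∘f≐Q xs
  ... | yes px | no ¬qx = contradiction (proj₁ P∘f≐Q px) ¬qx
  ... | no ¬px | yes qx = contradiction (proj₂ P∘f≐Q qx) ¬px

length-filter-[x] : {A : Set} {p : Level} {P : Pred A p} (P? : Decidable P) (x : A) →
                    length (filter P? (x ∷ [])) ≡ (if does (P? x) then 1 else 0)
length-filter-[x] P? x with does (P? x)
... | true  = refl
... | false = refl

module _ {n : ℕ} (π : Fin n → Fin n) (π-involutive : ∀ i → π (π i) ≡ i) where

  map-allFin-↭ : map π (allFin n) ↭ allFin n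
  map-allFin-↭ = ∼bag⇒↭ (unique∧set⇒bag (map⁺ π-injective (allFin⁺ n)) (allFin⁺ n)
    (λ {i} → mk⇔ (λ _ → ∈-allFin i) (λ _ → subst (_∈ map π (allFin n)) (π-involutive i) (∈-map⁺ π (∈-allFin (π i))))))
    where
    π-injective : ∀ {i j} → π i ≡ π j → i ≡ j
    π-injective {i} {j} πi≡πj = trans (sym (π-involutive i)) (trans (cong π πi≡πj) (π-involutive j))

  map-concatMap-allFin-↭ : {A B : Set} (h : A → B) {F : Fin n → List A} {G : Fin n → List B} →
                           (∀ i → map h (F i) ≡ G (π i)) → map h (concatMap F (allFin n)) ↭ concatMap G (allFin n)
  map-concatMap-allFin-↭ h {F} {G} hF≡Gπ = begin
    map h (concatMap F (allFin n))   ≡⟨ map-concatMap h F (allFin n) ⟩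
    concatMap (map h ∘ F) (allFin n) ≡⟨ concatMap-cong hF≡Gπ (allFin n) ⟩
    concatMap (G ∘ π) (allFin n)     ≡⟨ concatMap-map G π (allFin n) ⟨
    concatMap G (map π (allFin n))   ↭⟨ concatMap-↭ G map-allFin-↭ ⟩
    concatMap G (allFin n)           ∎
    where open PermutationReasoning

module _ {m n : ℕ} where

  IsTwoRegular : (Vertex m n → ℕ) → Set
  IsTwoRegular d = (i : Fin m) (j : Fin n) → d (i , j) ≡ 2

  isTwoRegular? : (d : Vertex m n → ℕ) → Dec (IsTwoRegular d)
  isTwoRegular? d = all? λ i → all? λ j → d (i , j) ≟ 2

  IsTwoRegular-resp : ∀ {d d′} → d ≗ d′ → IsTwoRegular d → IsTwoRegular d′
  IsTwoRegular-resp d≗d′ d-regular i j = trans (sym (d≗d′ (i , j))) (d-regular i j)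

  _+ends_ : (Vertex m n → ℕ) → Edge m n → Vertex m n → ℕ
  (d +ends e) v = d v + endsAt v e

  -- The number of sub-multisets S of es such that d plus the degree function of S is 2-regular.
  completions : List (Edge m n) → (Vertex m n → ℕ) → ℕ
  completions []       d = if does (isTwoRegular? d) then 1 else 0
  completions (e ∷ es) d = completions es (d +ends e) + completions es d

  completions-[]-resp : ∀ {d d′} → (IsTwoRegular d → IsTwoRegular d′) → (IsTwoRegular d′ → IsTwoRegular d) →
                        completions [] d ≡ completions [] d′
  completions-[]-resp to from =
    cong (λ b → if b then 1 else 0) (does-⇔ (mk⇔ to from) (isTwoRegular? _) (isTwoRegular? _))

  completions-cong : ∀ es {d d′} → d ≗ d′ → completions es d ≡ completions es d′
  completions-cong []       d≗d′ = completions-[]-resp (IsTwoRegular-resp d≗d′) (IsTwoRegular-resp (sym ∘ d≗d′))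
  completions-cong (e ∷ es) d≗d′ =
    cong₂ _+_ (completions-cong es (λ v → cong (_+ endsAt v e) (d≗d′ v))) (completions-cong es d≗d′)

  completions-swap : ∀ a b es d → completions (a ∷ b ∷ es) d ≡ completions (b ∷ a ∷ es) d
  completions-swap a b es d = trans
    (cong (λ k → k + C (d +ends a) + (C (d +ends b) + C d))
          (completions-cong es (λ v → xy∙z≈xz∙y (d v) (endsAt v a) (endsAt v b))))
    (interchange (C ((d +ends b) +ends a)) (C (d +ends a)) (C (d +ends b)) (C d))
    where
    C : (Vertex m n → ℕ) → ℕ
    C = completions es

  completions-↭ : ∀ {es es′} → es ↭ es′ → completions es ≗ completions es′
  completions-↭ ↭.refl                   d = refl
  completions-↭ (↭.prep e p)             d = cong₂ _+_ (completions-↭ p _) (completions-↭ p d)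
  completions-↭ (↭.swap {ys = ys} a b p) d = trans
    (cong₂ _+_ (cong₂ _+_ (completions-↭ p _) (completions-↭ p _)) (cong₂ _+_ (completions-↭ p _) (completions-↭ p d)))
    (completions-swap a b ys d)
  completions-↭ (↭.trans p q)            d = trans (completions-↭ p d) (completions-↭ q d)

  completions-map : (σ : Vertex m n → Vertex m n) (g : Edge m n → Edge m n) →
                    (∀ v → σ (σ v) ≡ v) → (∀ v e → endsAt v (g e) ≡ endsAt (σ v) e) →
                    ∀ es d → completions (map g es) (d ∘ σ) ≡ completions es d
  completions-map σ g σ-involutive ends-g []       d = completions-[]-resp unσ σ-regular
    where
    unσ : IsTwoRegular (d ∘ σ) → IsTwoRegular d
    unσ r i j = trans (cong d (sym (σ-involutive (i , j)))) (r (proj₁ (σ (i , j))) (proj₂ (σ (i , j))))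
    σ-regular : IsTwoRegular d → IsTwoRegular (d ∘ σ)
    σ-regular r i j = r (proj₁ (σ (i , j))) (proj₂ (σ (i , j)))
  completions-map σ g σ-involutive ends-g (e ∷ es) d = cong₂ _+_
    (trans (completions-cong (map g es) (λ v → cong (d (σ v) +_) (ends-g v e)))
           (completions-map σ g σ-involutive ends-g es (d +ends e)))
    (completions-map σ g σ-involutive ends-g es d)

  count-completions : ∀ es d →
    length (filter (λ s → isTwoRegular? (λ v → d v + deg es s v)) (allSelections (length es))) ≡ completions es d
  count-completions []       d = trans (length-filter-[x] (λ s → isTwoRegular? (λ v → d v + deg [] s v)) [])
    (completions-[]-resp (IsTwoRegular-resp (+-identityʳ ∘ d)) (IsTwoRegular-resp (sym ∘ +-identityʳ ∘ d)))
  count-completions (e ∷ es) d = begin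
    length (filter P? (map (true ∷_) S ++ map (false ∷_) S))
      ≡⟨ cong length (filter-++ P? (map (true ∷_) S) (map (false ∷_) S)) ⟩
    length (filter P? (map (true ∷_) S) ++ filter P? (map (false ∷_) S))
      ≡⟨ length-++ (filter P? (map (true ∷_) S)) ⟩
    length (filter P? (map (true ∷_) S)) + length (filter P? (map (false ∷_) S))
      ≡⟨ cong₂ _+_ (length-filter-map P? (Regular? (d +ends e)) (true ∷_) (reassociate , reassociate⁻¹) S)
                   (length-filter-map P? (Regular? d) (false ∷_) (id , id) S) ⟩
    length (filter (Regular? (d +ends e)) S) + length (filter (Regular? d) S)
      ≡⟨ cong₂ _+_ (count-completions es (d +ends e)) (count-completions es d) ⟩
    completions es (d +ends e) + completions es d ∎
    where
    open ≡-Reasoning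
    S : List (Vec Bool (length es))
    S = allSelections (length es)
    P? : (s : Vec Bool (suc (length es))) → Dec (IsTwoRegular (λ v → d v + deg (e ∷ es) s v))
    P? s = isTwoRegular? (λ v → d v + deg (e ∷ es) s v)
    Regular? : (d′ : Vertex m n → ℕ) (s : Vec Bool (length es)) → Dec (IsTwoRegular (λ v → d′ v + deg es s v))
    Regular? d′ s = isTwoRegular? (λ v → d′ v + deg es s v)
    reassociate : ∀ {s} → IsTwoRegular (λ v → d v + (endsAt v e + deg es s v)) →
                          IsTwoRegular (λ v → d v + endsAt v e + deg es s v)
    reassociate = IsTwoRegular-resp (λ v → sym (+-assoc (d v) (endsAt v e) _))
    reassociate⁻¹ : ∀ {s} → IsTwoRegular (λ v → d v + endsAt v e + deg es s v) →
                            IsTwoRegular (λ v → d v + (endsAt v e + deg es s v))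
    reassociate⁻¹ = IsTwoRegular-resp (λ v → +-assoc (d v) (endsAt v e) _)

fTG≡completions : ∀ m p n → fTG m p n ≡ completions (tgEdges m p n) (λ _ → 0)
fTG≡completions m p n = count-completions (tgEdges m p n) (λ _ → 0)

module _ {m n : ℕ} where

  verticalEdge : Fin m → Fin n → Edge m n
  verticalEdge i j = ((i , j) , down) , ((shift 1 i , j) , up)

  horizontalEdges : Fin m → Fin n → Maybe (Fin n) → List (Edge m n)
  horizontalEdges i j (just j′) = (((i , j) , right) , ((i , j′) , left)) ∷ []
  horizontalEdges i j nothing   = []

  wrapEdges : ℕ → Fin m → Fin n → Maybe (Fin n) → List (Edge m n)
  wrapEdges p i j (just _) = []
  wrapEdges p i j nothing  = (((shift p i , j) , right) , ((i , firstCol j) , left)) ∷ []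

torusEdges : (m p n : ℕ) → List (Edge m n)
torusEdges m p n =
     concatMap (λ i → map (verticalEdge i) (allFin n)) (allFin m)
  ++ concatMap (λ i → concatMap (λ j → horizontalEdges i j (nextCol j)) (allFin n)) (allFin m)
  ++ concatMap (λ i → concatMap (λ j → wrapEdges p i j (nextCol j)) (allFin n)) (allFin m)

mutual
  tgEdges≡torusEdges : ∀ m p n → tgEdges m p n ≡ torusEdges m p n
  tgEdges≡torusEdges m p n = cong (concatMap (λ i → map (verticalEdge i) (allFin n)) (allFin m) ++_) (cong₂ _++_
    (concatMap-cong (λ i → concatMap-cong (horizontalEdges-at p i) (allFin n)) (allFin m))
    (concatMap-cong (λ i → concatMap-cong (wrapEdges-at p i) (allFin n)) (allFin m)))

  -- The left-hand sides are the edge lists local to tgEdges, which cannot be named here and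
  -- are solved for from the use above; they depend on all of m p n, hence the argument p.
  horizontalEdges-at : ∀ {m n} (p : ℕ) (i : Fin m) (j : Fin n) → _ ≡ horizontalEdges i j (nextCol j)
  horizontalEdges-at p i j with nextCol j
  ... | just _  = refl
  ... | nothing = refl

  wrapEdges-at : ∀ {m n} (p : ℕ) (i : Fin m) (j : Fin n) → _ ≡ wrapEdges p i j (nextCol j)
  wrapEdges-at p i j with nextCol j
  ... | just _  = refl
  ... | nothing = refl

module Involution {m n : ℕ} (σ : Vertex m n → Vertex m n) (σ-involutive : ∀ v → σ (σ v) ≡ v) where

  [σ≟]₀₁≡[≟σ]₀₁ : ∀ u v → [ σ u ≟ v ]₀₁ ≡ [ u ≟ σ v ]₀₁
  [σ≟]₀₁≡[≟σ]₀₁ u v with σ u ≟V v | u ≟V σ v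
  ... | yes _    | yes _    = refl
  ... | no _     | no _     = refl
  ... | yes σu≡v | no u≢σv  = contradiction (trans (sym (σ-involutive u)) (cong σ σu≡v)) u≢σv
  ... | no σu≢v  | yes u≡σv = contradiction (trans (cong σ u≡σv) (σ-involutive v)) σu≢v

  [σ≟]₀₁+[σ≟]₀₁ : ∀ a b v → [ σ a ≟ v ]₀₁ + [ σ b ≟ v ]₀₁ ≡ [ a ≟ σ v ]₀₁ + [ b ≟ σ v ]₀₁
  [σ≟]₀₁+[σ≟]₀₁ a b v = cong₂ _+_ ([σ≟]₀₁≡[≟σ]₀₁ a v) ([σ≟]₀₁≡[≟σ]₀₁ b v)

module _ {K n : ℕ} where

  reflectVertex : Vertex (suc K) n → Vertex (suc K) n
  reflectVertex (i , j) = opposite i , j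

  reflectVertex-involutive : ∀ v → reflectVertex (reflectVertex v) ≡ v
  reflectVertex-involutive (i , j) = cong (_, j) (opposite-involutive i)

  open Involution reflectVertex reflectVertex-involutive using ([σ≟]₀₁+[σ≟]₀₁)

  -- Reflection reverses the vertical direction: the image of the up-end becomes the down-end.
  reflectEdge : Edge (suc K) n → Edge (suc K) n
  reflectEdge ((a , down)  , (b , db)) = (reflectVertex b , down)  , (reflectVertex a , up)
  reflectEdge ((a , up)    , (b , db)) = (reflectVertex a , up)    , (reflectVertex b , db)
  reflectEdge ((a , left)  , (b , db)) = (reflectVertex a , left)  , (reflectVertex b , db)
  reflectEdge ((a , right) , (b , db)) = (reflectVertex a , right) , (reflectVertex b , db)

  endsAt-reflectEdge : ∀ v e → endsAt v (reflectEdge e) ≡ endsAt (reflectVertex v) e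
  endsAt-reflectEdge v ((a , down)  , (b , _)) = trans (+-comm [ reflectVertex b ≟ v ]₀₁ _) ([σ≟]₀₁+[σ≟]₀₁ a b v)
  endsAt-reflectEdge v ((a , up)    , (b , _)) = [σ≟]₀₁+[σ≟]₀₁ a b v
  endsAt-reflectEdge v ((a , left)  , (b , _)) = [σ≟]₀₁+[σ≟]₀₁ a b v
  endsAt-reflectEdge v ((a , right) , (b , _)) = [σ≟]₀₁+[σ≟]₀₁ a b v

  torusEdges-reflect : ∀ p → p ≤ suc K → map reflectEdge (torusEdges (suc K) p n) ↭ torusEdges (suc K) (suc K ∸ p) n
  torusEdges-reflect p p≤1+K = begin
    map reflectEdge (V ++ H ++ W p)                        ≡⟨ map-++ reflectEdge V (H ++ W p) ⟩
    map reflectEdge V ++ map reflectEdge (H ++ W p)        ≡⟨ cong (map reflectEdge V ++_) (map-++ reflectEdge H (W p)) ⟩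
    map reflectEdge V ++ map reflectEdge H ++ map reflectEdge (W p)
      ↭⟨ ++⁺ vertical (++⁺ horizontal wrap) ⟩
    V ++ H ++ W (suc K ∸ p)                                ∎
    where
    open PermutationReasoning
    rows : List (Fin (suc K))
    rows = allFin (suc K)
    cols : List (Fin n)
    cols = allFin n
    V H : List (Edge (suc K) n)
    V = concatMap (λ i → map (verticalEdge i) cols) rows
    H = concatMap (λ i → concatMap (λ j → horizontalEdges i j (nextCol j)) cols) rows
    W : ℕ → List (Edge (suc K) n)
    W q = concatMap (λ i → concatMap (λ j → wrapEdges q i j (nextCol j)) cols) rows

    π : Fin (suc K) → Fin (suc K)
    π i = opposite (shift 1 i)
    π-involutive : ∀ i → π (π i) ≡ i
    π-involutive i = trans (cong opposite (shift₁-opposite-shift₁ i)) (opposite-involutive i)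

    vertical : map reflectEdge V ↭ V
    vertical = map-concatMap-allFin-↭ π π-involutive reflectEdge λ i → trans (sym (map-∘ cols))
      (map-cong (λ j → cong (λ k → ((π i , j) , down) , ((k , j) , up)) (sym (shift₁-opposite-shift₁ i))) cols)

    horizontal-cell : ∀ i j x → map reflectEdge (horizontalEdges i j x) ≡ horizontalEdges (opposite i) j x
    horizontal-cell i j (just _) = refl
    horizontal-cell i j nothing  = refl

    horizontal : map reflectEdge H ↭ H
    horizontal = map-concatMap-allFin-↭ opposite opposite-involutive reflectEdge λ i →
      trans (map-concatMap reflectEdge _ cols) (concatMap-cong (λ j → horizontal-cell i j (nextCol j)) cols)

    wrap-cell : ∀ i j x → map reflectEdge (wrapEdges p i j x) ≡ wrapEdges (suc K ∸ p) (opposite i) j x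
    wrap-cell i j (just _) = refl
    wrap-cell i j nothing  =
      cong (λ k → (((k , j) , right) , ((opposite i , firstCol j) , left)) ∷ []) (sym (shift-∸-opposite p i p≤1+K))

    wrap : map reflectEdge (W p) ↭ W (suc K ∸ p)
    wrap = map-concatMap-allFin-↭ opposite opposite-involutive reflectEdge λ i →
      trans (map-concatMap reflectEdge _ cols) (concatMap-cong (λ j → wrap-cell i j (nextCol j)) cols)

theorem9 : (m p : ℕ) → 2 ≤ m → 1 ≤ p → p ≤ m ∸ 1 →
    (n : ℕ) → 1 ≤ n → fTG m p n ≡ fTG m (m ∸ p) n
theorem9 zero      _ ()
theorem9 m@(suc K) p _ _ p≤K n _ = begin
  fTG m p n                                          ≡⟨ fTG≡completions m p n ⟩
  completions (tgEdges m p n) 0̇                      ≡⟨ cong (λ es → completions es 0̇) (tgEdges≡torusEdges m p n) ⟩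
  completions (torusEdges m p n) 0̇                   ≡⟨ completions-reflect (torusEdges m p n) ⟨
  completions (map reflectEdge (torusEdges m p n)) 0̇ ≡⟨ completions-↭ (torusEdges-reflect p (m≤n⇒m≤1+n p≤K)) 0̇ ⟩
  completions (torusEdges m (m ∸ p) n) 0̇             ≡⟨ cong (λ es → completions es 0̇) (tgEdges≡torusEdges m (m ∸ p) n) ⟨
  completions (tgEdges m (m ∸ p) n) 0̇                ≡⟨ fTG≡completions m (m ∸ p) n ⟨
  fTG m (m ∸ p) n                                    ∎
  where
  open ≡-Reasoning
  0̇ : Vertex m n → ℕ
  0̇ _ = 0
  completions-reflect : ∀ es → completions (map reflectEdge es) 0̇ ≡ completions es 0̇
  completions-reflect es = completions-map reflectVertex reflectEdge reflectVertex-involutive endsAt-reflectEdge es 0̇
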